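{- The rule $\mathsf{e}\downarrow$ permutes over each of the rules $\mathsf{e}\uparrow$, $\mathsf{ai}\downarrow$, $\mathsf{ai}\uparrow$, $\mathsf{s}$, $\mathsf{q}\downarrow$, $\mathsf{q}\uparrow$, $\mathsf{p}\downarrow$, $\mathsf{p}\uparrow$, $\mathsf{w}\uparrow$, and $\mathsf{g}\downarrow$ by the system $\{\mathsf{s},\mathsf{q}\downarrow,\mathsf{q}\uparrow\}$.
   Context: Atoms: countably many atoms $a,b,\dots$, each atom $a$ having a dual atom $\bar a$ with $\bar{\bar a}=a$. Structures are generated by $S::= a\mid \circ \mid [S,\dots,S]\mid (S,\dots,S)\mid \langle S;\dots;S\rangle \mid ?S\mid !S\mid \bar S$ (par, tensor, seq with at least one argument; unit $\circ$ not an atom), identified modulo the least congruence $=$ making par, tensor, seq associative, par and tensor commutative, $\circ$ a unit for all three, $[R]=(R)=\langle R\rangle=R$, with $\bar\circ=\circ$, $\overline{[R_1,\dots,R_h]}=(\bar R_1,\dots,\bar R_h)$, $\overline{(R_1,\dots,R_h)}=[\bar R_1,\dots,\bar R_h]$, $\overline{\langle R_1;\dots;R_h\rangle}=\langle\bar R_1;\dots;\bar R_h\rangle$, $\overline{?R}=!\bar R$, $\overline{!R}=?\bar R$, $\bar{\bar R}=R$. A context $S\{\;\}$ is a structure with one hole not under negation; $S[R,T]$ abbreviates $S\{[R,T]\}$ etc. A derivation in a rule set is a finite vertical chain of rule instances (each conclusion equal modulo $=$ to the next premise), possibly a single structure; top = premise, bottom = conclusion. Rules (premise $\Rightarrow$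 conclusion): $\mathsf{ai}\downarrow$: $S\{\circ\}\Rightarrow S[a,\bar a]$; $\mathsf{ai}\uparrow$: $S(a,\bar a)\Rightarrow S\{\circ\}$; $\mathsf{s}$: $S([R,U],T)\Rightarrow S[(R,T),U]$; $\mathsf{q}\downarrow$: $S\langle[R,U];[T,V]\rangle\Rightarrow S[\langle R;T\rangle,\langle U;V\rangle]$; $\mathsf{q}\uparrow$: $S(\langle R;U\rangle,\langle T;V\rangle)\Rightarrow S\langle(R,T);(U,V)\rangle$; $\mathsf{p}\downarrow$: $S\{![R,T]\}\Rightarrow S[!R,?T]$; $\mathsf{p}\uparrow$: $S(?R,!T)\Rightarrow S\{?(R,T)\}$; $\mathsf{e}\downarrow$: $S\{\circ\}\Rightarrow S\{!\circ\}$; $\mathsf{e}\uparrow$: $S\{?\circ\}\Rightarrow S\{\circ\}$; $\mathsf{w}\uparrow$: $S\{!R\}\Rightarrow S\{\circ\}$; $\mathsf{g}\downarrow$: $S\{??R\}\Rightarrow S\{?R\}$. A rule $\pi$ permutes over a rule $\rho$ by a system $\mathcal X$ if for every derivation consisting of an instance of $\rho$ with premise $Q$ and conclusion $U$ followed (below) by an instance of $\pi$ with premise $U$ and conclusion $P$, there are structures $V,W$ and a derivation consisting of an instance of $\pi$ from $Q$ to $V$, followed by an instance of $\rho$ from $V$ to $W$, followed by a derivation in $\mathcal X$ from $W$ to $P$. -}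

module Defs where

open import Data.Nat using (ℕ)
open import Data.Bool using (Bool; not)
open import Data.Product using (_×_; _,_; Σ; Σ-syntax)
open import Data.List using (List)
open import Data.List.Membership.Propositional using (_∈_)

record Atom : Set where
  constructor mkAtom
  field
    name     : ℕ
    polarity : Bool

dual : Atom → Atom
dual (mkAtom n b) = mkAtom n (not b)

-- The n-ary par/tensor/seq (h ≥ 1) are represented by binary
-- constructors; since they are associative modulo =, and [R] = (R) = <R> = R,
-- this is the same set of structures modulo =.

data Str : Set where
  atom : Atom → Str
  unit : Str
  par  : Str → Str → Str
  ten  : Str → Str → Str
  seq  : Str → Str → Str
  wn   : Str → Str
  oc   : Str → Str
  neg  : Str → Str

infix 4 _≈_
data _≈_ : Str → Str → Set where
  ≈-refl  : ∀ {R} → R ≈ R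
  ≈-sym   : ∀ {R T} → R ≈ T → T ≈ R
  ≈-trans : ∀ {R T U} → R ≈ T → T ≈ U → R ≈ U
  par-cong : ∀ {R R′ T T′} → R ≈ R′ → T ≈ T′ → par R T ≈ par R′ T′
  ten-cong : ∀ {R R′ T T′} → R ≈ R′ → T ≈ T′ → ten R T ≈ ten R′ T′
  seq-cong : ∀ {R R′ T T′} → R ≈ R′ → T ≈ T′ → seq R T ≈ seq R′ T′
  wn-cong  : ∀ {R R′} → R ≈ R′ → wn R ≈ wn R′
  oc-cong  : ∀ {R R′} → R ≈ R′ → oc R ≈ oc R′
  neg-cong : ∀ {R R′} → R ≈ R′ → neg R ≈ neg R′
  par-assoc : ∀ {R T U} → par (par R T) U ≈ par R (par T U)
  ten-assoc : ∀ {R T U} → ten (ten R T) U ≈ ten R (ten T U)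
  seq-assoc : ∀ {R T U} → seq (seq R T) U ≈ seq R (seq T U)
  par-comm : ∀ {R T} → par R T ≈ par T R
  ten-comm : ∀ {R T} → ten R T ≈ ten T R
  par-unitˡ : ∀ {R} → par unit R ≈ R
  par-unitʳ : ∀ {R} → par R unit ≈ R
  ten-unitˡ : ∀ {R} → ten unit R ≈ R
  ten-unitʳ : ∀ {R} → ten R unit ≈ R
  seq-unitˡ : ∀ {R} → seq unit R ≈ R
  seq-unitʳ : ∀ {R} → seq R unit ≈ R
  neg-atom : ∀ {a} → neg (atom a) ≈ atom (dual a)
  neg-unit : neg unit ≈ unit
  neg-par  : ∀ {R T} → neg (par R T) ≈ ten (neg R) (neg T)
  neg-ten  : ∀ {R T} → neg (ten R T) ≈ par (neg R) (neg T)
  neg-seq  : ∀ {R T} → neg (seq R T) ≈ seq (neg R) (neg T)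
  neg-wn   : ∀ {R} → neg (wn R) ≈ oc (neg R)
  neg-oc   : ∀ {R} → neg (oc R) ≈ wn (neg R)
  neg-neg  : ∀ {R} → neg (neg R) ≈ R

data Ctx : Set where
  hole : Ctx
  parˡ : Ctx → Str → Ctx
  parʳ : Str → Ctx → Ctx
  tenˡ : Ctx → Str → Ctx
  tenʳ : Str → Ctx → Ctx
  seqˡ : Ctx → Str → Ctx
  seqʳ : Str → Ctx → Ctx
  wnᶜ  : Ctx → Ctx
  ocᶜ  : Ctx → Ctx

_⟦_⟧ : Ctx → Str → Str
hole     ⟦ R ⟧ = R
parˡ S T ⟦ R ⟧ = par (S ⟦ R ⟧) T
parʳ T S ⟦ R ⟧ = par T (S ⟦ R ⟧)
tenˡ S T ⟦ R ⟧ = ten (S ⟦ R ⟧) T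
tenʳ T S ⟦ R ⟧ = ten T (S ⟦ R ⟧)
seqˡ S T ⟦ R ⟧ = seq (S ⟦ R ⟧) T
seqʳ T S ⟦ R ⟧ = seq T (S ⟦ R ⟧)
wnᶜ S    ⟦ R ⟧ = wn (S ⟦ R ⟧)
ocᶜ S    ⟦ R ⟧ = oc (S ⟦ R ⟧)

data Rule : Set where
  ai↓ ai↑ s q↓ q↑ p↓ p↑ e↓ e↑ w↑ g↓ : Rule

-- Redex (premise filling of the hole) and contractum (conclusion filling).
data Redex : Rule → Str → Str → Set where
  ai↓-r : ∀ a → Redex ai↓ unit (par (atom a) (atom (dual a)))
  ai↑-r : ∀ a → Redex ai↑ (ten (atom a) (atom (dual a))) unit
  s-r   : ∀ R U T → Redex s (ten (par R U) T) (par (ten R T) U)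
  q↓-r  : ∀ R U T V → Redex q↓ (seq (par R U) (par T V)) (par (seq R T) (seq U V))
  q↑-r  : ∀ R U T V → Redex q↑ (ten (seq R U) (seq T V)) (seq (ten R T) (ten U V))
  p↓-r  : ∀ R T → Redex p↓ (oc (par R T)) (par (oc R) (wn T))
  p↑-r  : ∀ R T → Redex p↑ (ten (wn R) (oc T)) (wn (ten R T))
  e↓-r  : Redex e↓ unit (oc unit)
  e↑-r  : Redex e↑ (wn unit) unit
  w↑-r  : ∀ R → Redex w↑ (oc R) unit
  g↓-r  : ∀ R → Redex g↓ (wn (wn R)) (wn R)

Inst : Rule → Str → Str → Set
Inst ρ P C = Σ[ S ∈ Ctx ] Σ[ R ∈ Str ] Σ[ T ∈ Str ]
  (Redex ρ R T × P ≈ S ⟦ R ⟧ × C ≈ S ⟦ T ⟧)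

-- Derivations in a rule system X from top (premise) P to bottom (conclusion) C.
data Deriv (X : Rule → Set) : Str → Str → Set where
  single : ∀ {P C} → P ≈ C → Deriv X P C
  step   : ∀ {P U C} (ρ : Rule) → X ρ → Inst ρ P U → Deriv X U C → Deriv X P C

System : List Rule → Rule → Set
System rs ρ = ρ ∈ rs

PermutesOver : Rule → Rule → (Rule → Set) → Set
PermutesOver π ρ X = ∀ {Q U P} → Inst ρ Q U → Inst π U P →
  Σ[ V ∈ Str ] Σ[ W ∈ Str ] (Inst π Q V × Inst ρ V W × Deriv X W P)

-- If the hole of the e↓ instance is not under a modality, its !∘ can be created first,
-- as a tensor factor beside the whole premise: the ρ step is then unaffected, and s and
-- q↑ move !∘ into place.  Otherwise consider the outermost box ?Y or !Y around the hole.
-- Boxes are rigid under =, so this box can be traced through the ρ instance: it lies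
-- beside the redex (the two instances commute), inside the contractum (inspect the
-- rule; for p↑ and e↓ the tensor argument is used again inside the box), or around the
-- redex (recurse on the smaller context inside the box).
module Submission where

open import Defs
open import Data.Bool.Properties using (not-involutive)
open import Data.List using ([]; _∷_)
open import Data.List.Membership.Propositional using (_∈_)
open import Data.List.Relation.Unary.Any using (here; there)
open import Data.Nat using (ℕ; zero; suc; _<_)
open import Data.Nat.Base using (s≤s⁻¹)
open import Data.Nat.Properties using (n<1+n; m<n⇒m<1+n; <-≤-trans)
open import Data.Product using (_×_; _,_; Σ-syntax; proj₁)
open import Data.Sum using (_⊎_; inj₁; inj₂; map₂)
open import Data.Empty using (⊥)
open import Data.Unit using (⊤; tt)
open import Relation.Binary.PropositionalEquality
  using (_≡_; refl; sym; trans; cong; subst)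

!∘ : Str
!∘ = oc unit

≡⇒≈ : ∀ {A B} → A ≡ B → A ≈ B
≡⇒≈ refl = ≈-refl

infixr 9 _∘ᶜ_
_∘ᶜ_ : Ctx → Ctx → Ctx
hole     ∘ᶜ D = D
parˡ C T ∘ᶜ D = parˡ (C ∘ᶜ D) T
parʳ T C ∘ᶜ D = parʳ T (C ∘ᶜ D)
tenˡ C T ∘ᶜ D = tenˡ (C ∘ᶜ D) T
tenʳ T C ∘ᶜ D = tenʳ T (C ∘ᶜ D)
seqˡ C T ∘ᶜ D = seqˡ (C ∘ᶜ D) T
seqʳ T C ∘ᶜ D = seqʳ T (C ∘ᶜ D)
wnᶜ C    ∘ᶜ D = wnᶜ (C ∘ᶜ D)
ocᶜ C    ∘ᶜ D = ocᶜ (C ∘ᶜ D)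

∘ᶜ-⟦⟧ : ∀ C D R → (C ∘ᶜ D) ⟦ R ⟧ ≡ C ⟦ D ⟦ R ⟧ ⟧
∘ᶜ-⟦⟧ hole       D R = refl
∘ᶜ-⟦⟧ (parˡ C T) D R = cong (λ A → par A T) (∘ᶜ-⟦⟧ C D R)
∘ᶜ-⟦⟧ (parʳ T C) D R = cong (par T) (∘ᶜ-⟦⟧ C D R)
∘ᶜ-⟦⟧ (tenˡ C T) D R = cong (λ A → ten A T) (∘ᶜ-⟦⟧ C D R)
∘ᶜ-⟦⟧ (tenʳ T C) D R = cong (ten T) (∘ᶜ-⟦⟧ C D R)
∘ᶜ-⟦⟧ (seqˡ C T) D R = cong (λ A → seq A T) (∘ᶜ-⟦⟧ C D R)
∘ᶜ-⟦⟧ (seqʳ T C) D R = cong (seq T) (∘ᶜ-⟦⟧ C D R)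
∘ᶜ-⟦⟧ (wnᶜ C)    D R = cong wn (∘ᶜ-⟦⟧ C D R)
∘ᶜ-⟦⟧ (ocᶜ C)    D R = cong oc (∘ᶜ-⟦⟧ C D R)

⟦⟧-cong : ∀ C {A B} → A ≈ B → C ⟦ A ⟧ ≈ C ⟦ B ⟧
⟦⟧-cong hole       p = p
⟦⟧-cong (parˡ C T) p = par-cong (⟦⟧-cong C p) ≈-refl
⟦⟧-cong (parʳ T C) p = par-cong ≈-refl (⟦⟧-cong C p)
⟦⟧-cong (tenˡ C T) p = ten-cong (⟦⟧-cong C p) ≈-refl
⟦⟧-cong (tenʳ T C) p = ten-cong ≈-refl (⟦⟧-cong C p)
⟦⟧-cong (seqˡ C T) p = seq-cong (⟦⟧-cong C p) ≈-refl
⟦⟧-cong (seqʳ T C) p = seq-cong ≈-refl (⟦⟧-cong C p)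
⟦⟧-cong (wnᶜ C)    p = wn-cong (⟦⟧-cong C p)
⟦⟧-cong (ocᶜ C)    p = oc-cong (⟦⟧-cong C p)

ModalityFree : Ctx → Set
ModalityFree hole       = ⊤
ModalityFree (parˡ C _) = ModalityFree C
ModalityFree (parʳ _ C) = ModalityFree C
ModalityFree (tenˡ C _) = ModalityFree C
ModalityFree (tenʳ _ C) = ModalityFree C
ModalityFree (seqˡ C _) = ModalityFree C
ModalityFree (seqʳ _ C) = ModalityFree C
ModalityFree (wnᶜ _)    = ⊥
ModalityFree (ocᶜ _)    = ⊥

size : Ctx → ℕ
size hole       = zero
size (parˡ C _) = suc (size C)
size (parʳ _ C) = suc (size C)
size (tenˡ C _) = suc (size C)
size (tenʳ _ C) = suc (size C)
size (seqˡ C _) = suc (size C)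
size (seqʳ _ C) = suc (size C)
size (wnᶜ C)    = suc (size C)
size (ocᶜ C)    = suc (size C)

Redex⇒Inst : ∀ {ρ R T} → Redex ρ R T → Inst ρ R T
Redex⇒Inst r = hole , _ , _ , r , ≈-refl , ≈-refl

Inst-resp : ∀ {ρ A B A′ B′} → A′ ≈ A → B ≈ B′ → Inst ρ A B → Inst ρ A′ B′
Inst-resp a b (S , R , T , r , p , q) = S , R , T , r , ≈-trans a p , ≈-trans (≈-sym b) q

Inst-lift : ∀ {ρ A B} C → Inst ρ A B → Inst ρ (C ⟦ A ⟧) (C ⟦ B ⟧)
Inst-lift C (S , R , T , r , p , q) =
  C ∘ᶜ S , R , T , r ,
  ≈-trans (⟦⟧-cong C p) (≡⇒≈ (sym (∘ᶜ-⟦⟧ C S R))) ,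
  ≈-trans (⟦⟧-cong C q) (≡⇒≈ (sym (∘ᶜ-⟦⟧ C S T)))

e↓-in : ∀ K {Y Y′} → Y ≈ K ⟦ unit ⟧ → Y′ ≈ K ⟦ !∘ ⟧ → Inst e↓ Y Y′
e↓-in K y y′ = K , _ , _ , e↓-r , y , y′

module _ {X : Rule → Set} where

  Deriv-trans : ∀ {A B C} → Deriv X A B → Deriv X B C → Deriv X A C
  Deriv-trans (single p) (single q) = single (≈-trans p q)
  Deriv-trans (single p) (step ρ x i d) = step ρ x (Inst-resp p ≈-refl i) d
  Deriv-trans (step ρ x i d) e = step ρ x i (Deriv-trans d e)

  Deriv-lift : ∀ {A B} C → Deriv X A B → Deriv X (C ⟦ A ⟧) (C ⟦ B ⟧)
  Deriv-lift C (single p) = single (⟦⟧-cong C p)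
  Deriv-lift C (step ρ x i d) = step ρ x (Inst-lift C i) (Deriv-lift C d)

  module _ (s∈X : X s) (q↑∈X : X q↑) where

    ten-into-hole : ∀ Z S → ModalityFree S → Deriv X (ten Z (S ⟦ unit ⟧)) (S ⟦ Z ⟧)
    ten-into-hole Z hole _ = single ten-unitʳ
    ten-into-hole Z (parˡ S T) mf =
      step s s∈X (hole , _ , _ , s-r (S ⟦ unit ⟧) T Z , ten-comm , ≈-refl)
        (Deriv-trans (single (par-cong ten-comm ≈-refl))
          (Deriv-lift (parˡ hole T) (ten-into-hole Z S mf)))
    ten-into-hole Z (parʳ T S) mf =
      step s s∈X (hole , _ , _ , s-r (S ⟦ unit ⟧) T Z ,
                  ≈-trans ten-comm (ten-cong par-comm ≈-refl) , ≈-refl)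
        (Deriv-trans (single (≈-trans par-comm (par-cong ≈-refl ten-comm)))
          (Deriv-lift (parʳ T hole) (ten-into-hole Z S mf)))
    ten-into-hole Z (tenˡ S T) mf =
      Deriv-trans (single (≈-sym ten-assoc)) (Deriv-lift (tenˡ hole T) (ten-into-hole Z S mf))
    ten-into-hole Z (tenʳ T S) mf =
      Deriv-trans (single (≈-trans (≈-sym ten-assoc) (≈-trans (ten-cong ten-comm ≈-refl) ten-assoc)))
        (Deriv-lift (tenʳ T hole) (ten-into-hole Z S mf))
    ten-into-hole Z (seqˡ S T) mf =
      step q↑ q↑∈X (hole , _ , _ , q↑-r Z unit (S ⟦ unit ⟧) T ,
                    ten-cong (≈-sym seq-unitʳ) ≈-refl , ≈-refl)
        (Deriv-trans (single (seq-cong ≈-refl ten-unitˡ))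
          (Deriv-lift (seqˡ hole T) (ten-into-hole Z S mf)))
    ten-into-hole Z (seqʳ T S) mf =
      step q↑ q↑∈X (hole , _ , _ , q↑-r unit Z T (S ⟦ unit ⟧) ,
                    ten-cong (≈-sym seq-unitˡ) ≈-refl , ≈-refl)
        (Deriv-trans (single (seq-cong ten-unitˡ ≈-refl))
          (Deriv-lift (seqʳ T hole) (ten-into-hole Z S mf)))

Permuted : (Rule → Set) → Rule → Str → Str → Set
Permuted X ρ Q P = Σ[ V ∈ Str ] Σ[ W ∈ Str ] (Inst e↓ Q V × Inst ρ V W × Deriv X W P)

Permuted-resp : ∀ {X ρ Q Q′ P P′} → Q′ ≈ Q → P ≈ P′ →
  Permuted X ρ Q P → Permuted X ρ Q′ P′
Permuted-resp q p (V , W , i , j , d) = V , W , Inst-resp q ≈-refl i , j , Deriv-trans d (single p)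

Permuted-lift : ∀ {X ρ Q P} C → Permuted X ρ Q P → Permuted X ρ (C ⟦ Q ⟧) (C ⟦ P ⟧)
Permuted-lift C (V , W , i , j , d) = C ⟦ V ⟧ , C ⟦ W ⟧ , Inst-lift C i , Inst-lift C j , Deriv-lift C d

-- Boxes can be traced along = only after pushing negations to the atoms, which turns =
-- into the congruence _≈⁺_ generated by the negation-free laws (its constructors
-- deliberately reuse the names of those of _≈_).

nnf⁺ nnf⁻ : Str → Str
nnf⁺ (atom a)  = atom a
nnf⁺ unit      = unit
nnf⁺ (par A B) = par (nnf⁺ A) (nnf⁺ B)
nnf⁺ (ten A B) = ten (nnf⁺ A) (nnf⁺ B)
nnf⁺ (seq A B) = seq (nnf⁺ A) (nnf⁺ B)
nnf⁺ (wn A)    = wn (nnf⁺ A)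
nnf⁺ (oc A)    = oc (nnf⁺ A)
nnf⁺ (neg A)   = nnf⁻ A
nnf⁻ (atom a)  = atom (dual a)
nnf⁻ unit      = unit
nnf⁻ (par A B) = ten (nnf⁻ A) (nnf⁻ B)
nnf⁻ (ten A B) = par (nnf⁻ A) (nnf⁻ B)
nnf⁻ (seq A B) = seq (nnf⁻ A) (nnf⁻ B)
nnf⁻ (wn A)    = oc (nnf⁻ A)
nnf⁻ (oc A)    = wn (nnf⁻ A)
nnf⁻ (neg A)   = nnf⁺ A

nnf⁺-sound : ∀ A → nnf⁺ A ≈ A
nnf⁻-sound : ∀ A → nnf⁻ A ≈ neg A
nnf⁺-sound (atom a)  = ≈-refl
nnf⁺-sound unit      = ≈-refl
nnf⁺-sound (par A B) = par-cong (nnf⁺-sound A) (nnf⁺-sound B)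
nnf⁺-sound (ten A B) = ten-cong (nnf⁺-sound A) (nnf⁺-sound B)
nnf⁺-sound (seq A B) = seq-cong (nnf⁺-sound A) (nnf⁺-sound B)
nnf⁺-sound (wn A)    = wn-cong (nnf⁺-sound A)
nnf⁺-sound (oc A)    = oc-cong (nnf⁺-sound A)
nnf⁺-sound (neg A)   = nnf⁻-sound A
nnf⁻-sound (atom a)  = ≈-sym neg-atom
nnf⁻-sound unit      = ≈-sym neg-unit
nnf⁻-sound (par A B) = ≈-trans (ten-cong (nnf⁻-sound A) (nnf⁻-sound B)) (≈-sym neg-par)
nnf⁻-sound (ten A B) = ≈-trans (par-cong (nnf⁻-sound A) (nnf⁻-sound B)) (≈-sym neg-ten)
nnf⁻-sound (seq A B) = ≈-trans (seq-cong (nnf⁻-sound A) (nnf⁻-sound B)) (≈-sym neg-seq)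
nnf⁻-sound (wn A)    = ≈-trans (oc-cong (nnf⁻-sound A)) (≈-sym neg-wn)
nnf⁻-sound (oc A)    = ≈-trans (wn-cong (nnf⁻-sound A)) (≈-sym neg-oc)
nnf⁻-sound (neg A)   = ≈-trans (nnf⁺-sound A) (≈-sym neg-neg)

infix 4 _≈⁺_
data _≈⁺_ : Str → Str → Set where
  ≈-refl    : ∀ {R} → R ≈⁺ R
  ≈-sym     : ∀ {R T} → R ≈⁺ T → T ≈⁺ R
  ≈-trans   : ∀ {R T U} → R ≈⁺ T → T ≈⁺ U → R ≈⁺ U
  par-cong  : ∀ {R R′ T T′} → R ≈⁺ R′ → T ≈⁺ T′ → par R T ≈⁺ par R′ T′
  ten-cong  : ∀ {R R′ T T′} → R ≈⁺ R′ → T ≈⁺ T′ → ten R T ≈⁺ ten R′ T′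
  seq-cong  : ∀ {R R′ T T′} → R ≈⁺ R′ → T ≈⁺ T′ → seq R T ≈⁺ seq R′ T′
  wn-cong   : ∀ {R R′} → R ≈⁺ R′ → wn R ≈⁺ wn R′
  oc-cong   : ∀ {R R′} → R ≈⁺ R′ → oc R ≈⁺ oc R′
  par-assoc : ∀ {R T U} → par (par R T) U ≈⁺ par R (par T U)
  ten-assoc : ∀ {R T U} → ten (ten R T) U ≈⁺ ten R (ten T U)
  seq-assoc : ∀ {R T U} → seq (seq R T) U ≈⁺ seq R (seq T U)
  par-comm  : ∀ {R T} → par R T ≈⁺ par T R
  ten-comm  : ∀ {R T} → ten R T ≈⁺ ten T R
  par-unitˡ : ∀ {R} → par unit R ≈⁺ R
  par-unitʳ : ∀ {R} → par R unit ≈⁺ R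
  ten-unitˡ : ∀ {R} → ten unit R ≈⁺ R
  ten-unitʳ : ∀ {R} → ten R unit ≈⁺ R
  seq-unitˡ : ∀ {R} → seq unit R ≈⁺ R
  seq-unitʳ : ∀ {R} → seq R unit ≈⁺ R

≈⁺⇒≈ : ∀ {A B} → A ≈⁺ B → A ≈ B
≈⁺⇒≈ ≈-refl         = ≈-refl
≈⁺⇒≈ (≈-sym p)      = ≈-sym (≈⁺⇒≈ p)
≈⁺⇒≈ (≈-trans p q)  = ≈-trans (≈⁺⇒≈ p) (≈⁺⇒≈ q)
≈⁺⇒≈ (par-cong p q) = par-cong (≈⁺⇒≈ p) (≈⁺⇒≈ q)
≈⁺⇒≈ (ten-cong p q) = ten-cong (≈⁺⇒≈ p) (≈⁺⇒≈ q)
≈⁺⇒≈ (seq-cong p q) = seq-cong (≈⁺⇒≈ p) (≈⁺⇒≈ q)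
≈⁺⇒≈ (wn-cong p)    = wn-cong (≈⁺⇒≈ p)
≈⁺⇒≈ (oc-cong p)    = oc-cong (≈⁺⇒≈ p)
≈⁺⇒≈ par-assoc      = par-assoc
≈⁺⇒≈ ten-assoc      = ten-assoc
≈⁺⇒≈ seq-assoc      = seq-assoc
≈⁺⇒≈ par-comm       = par-comm
≈⁺⇒≈ ten-comm       = ten-comm
≈⁺⇒≈ par-unitˡ      = par-unitˡ
≈⁺⇒≈ par-unitʳ      = par-unitʳ
≈⁺⇒≈ ten-unitˡ      = ten-unitˡ
≈⁺⇒≈ ten-unitʳ      = ten-unitʳ
≈⁺⇒≈ seq-unitˡ      = seq-unitˡ
≈⁺⇒≈ seq-unitʳ      = seq-unitʳ

dual-involutive : ∀ a → dual (dual a) ≡ a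
dual-involutive (mkAtom n b) = cong (mkAtom n) (not-involutive b)

≈⇒nnf-≈⁺ : ∀ {A B} → A ≈ B → nnf⁺ A ≈⁺ nnf⁺ B × nnf⁻ A ≈⁺ nnf⁻ B
≈⇒nnf-≈⁺ ≈-refl = ≈-refl , ≈-refl
≈⇒nnf-≈⁺ (≈-sym p) with ≈⇒nnf-≈⁺ p
... | p⁺ , p⁻ = ≈-sym p⁺ , ≈-sym p⁻
≈⇒nnf-≈⁺ (≈-trans p q) with ≈⇒nnf-≈⁺ p | ≈⇒nnf-≈⁺ q
... | p⁺ , p⁻ | q⁺ , q⁻ = ≈-trans p⁺ q⁺ , ≈-trans p⁻ q⁻
≈⇒nnf-≈⁺ (par-cong p q) with ≈⇒nnf-≈⁺ p | ≈⇒nnf-≈⁺ q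
... | p⁺ , p⁻ | q⁺ , q⁻ = par-cong p⁺ q⁺ , ten-cong p⁻ q⁻
≈⇒nnf-≈⁺ (ten-cong p q) with ≈⇒nnf-≈⁺ p | ≈⇒nnf-≈⁺ q
... | p⁺ , p⁻ | q⁺ , q⁻ = ten-cong p⁺ q⁺ , par-cong p⁻ q⁻
≈⇒nnf-≈⁺ (seq-cong p q) with ≈⇒nnf-≈⁺ p | ≈⇒nnf-≈⁺ q
... | p⁺ , p⁻ | q⁺ , q⁻ = seq-cong p⁺ q⁺ , seq-cong p⁻ q⁻
≈⇒nnf-≈⁺ (wn-cong p) with ≈⇒nnf-≈⁺ p
... | p⁺ , p⁻ = wn-cong p⁺ , oc-cong p⁻
≈⇒nnf-≈⁺ (oc-cong p) with ≈⇒nnf-≈⁺ p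
... | p⁺ , p⁻ = oc-cong p⁺ , wn-cong p⁻
≈⇒nnf-≈⁺ (neg-cong p) with ≈⇒nnf-≈⁺ p
... | p⁺ , p⁻ = p⁻ , p⁺
≈⇒nnf-≈⁺ par-assoc = par-assoc , ten-assoc
≈⇒nnf-≈⁺ ten-assoc = ten-assoc , par-assoc
≈⇒nnf-≈⁺ seq-assoc = seq-assoc , seq-assoc
≈⇒nnf-≈⁺ par-comm  = par-comm , ten-comm
≈⇒nnf-≈⁺ ten-comm  = ten-comm , par-comm
≈⇒nnf-≈⁺ par-unitˡ = par-unitˡ , ten-unitˡ
≈⇒nnf-≈⁺ par-unitʳ = par-unitʳ , ten-unitʳ
≈⇒nnf-≈⁺ ten-unitˡ = ten-unitˡ , par-unitˡ
≈⇒nnf-≈⁺ ten-unitʳ = ten-unitʳ , par-unitʳ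
≈⇒nnf-≈⁺ seq-unitˡ = seq-unitˡ , seq-unitˡ
≈⇒nnf-≈⁺ seq-unitʳ = seq-unitʳ , seq-unitʳ
≈⇒nnf-≈⁺ (neg-atom {a}) =
  ≈-refl , subst (λ b → atom b ≈⁺ atom (dual (dual a))) (dual-involutive a) ≈-refl
≈⇒nnf-≈⁺ neg-unit  = ≈-refl , ≈-refl
≈⇒nnf-≈⁺ neg-par   = ≈-refl , ≈-refl
≈⇒nnf-≈⁺ neg-ten   = ≈-refl , ≈-refl
≈⇒nnf-≈⁺ neg-seq   = ≈-refl , ≈-refl
≈⇒nnf-≈⁺ neg-wn    = ≈-refl , ≈-refl
≈⇒nnf-≈⁺ neg-oc    = ≈-refl , ≈-refl
≈⇒nnf-≈⁺ neg-neg   = ≈-refl , ≈-refl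

nnfᶜ : Ctx → Ctx
nnfᶜ hole       = hole
nnfᶜ (parˡ S T) = parˡ (nnfᶜ S) (nnf⁺ T)
nnfᶜ (parʳ T S) = parʳ (nnf⁺ T) (nnfᶜ S)
nnfᶜ (tenˡ S T) = tenˡ (nnfᶜ S) (nnf⁺ T)
nnfᶜ (tenʳ T S) = tenʳ (nnf⁺ T) (nnfᶜ S)
nnfᶜ (seqˡ S T) = seqˡ (nnfᶜ S) (nnf⁺ T)
nnfᶜ (seqʳ T S) = seqʳ (nnf⁺ T) (nnfᶜ S)
nnfᶜ (wnᶜ S)    = wnᶜ (nnfᶜ S)
nnfᶜ (ocᶜ S)    = ocᶜ (nnfᶜ S)

nnf⁺-⟦⟧ : ∀ S A → nnf⁺ (S ⟦ A ⟧) ≡ nnfᶜ S ⟦ nnf⁺ A ⟧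
nnf⁺-⟦⟧ hole       A = refl
nnf⁺-⟦⟧ (parˡ S T) A = cong (λ B → par B (nnf⁺ T)) (nnf⁺-⟦⟧ S A)
nnf⁺-⟦⟧ (parʳ T S) A = cong (par (nnf⁺ T)) (nnf⁺-⟦⟧ S A)
nnf⁺-⟦⟧ (tenˡ S T) A = cong (λ B → ten B (nnf⁺ T)) (nnf⁺-⟦⟧ S A)
nnf⁺-⟦⟧ (tenʳ T S) A = cong (ten (nnf⁺ T)) (nnf⁺-⟦⟧ S A)
nnf⁺-⟦⟧ (seqˡ S T) A = cong (λ B → seq B (nnf⁺ T)) (nnf⁺-⟦⟧ S A)
nnf⁺-⟦⟧ (seqʳ T S) A = cong (seq (nnf⁺ T)) (nnf⁺-⟦⟧ S A)
nnf⁺-⟦⟧ (wnᶜ S)    A = cong wn (nnf⁺-⟦⟧ S A)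
nnf⁺-⟦⟧ (ocᶜ S)    A = cong oc (nnf⁺-⟦⟧ S A)

Redex-nnf : ∀ {ρ R T} → Redex ρ R T → Redex ρ (nnf⁺ R) (nnf⁺ T)
Redex-nnf (ai↓-r a)        = ai↓-r a
Redex-nnf (ai↑-r a)        = ai↑-r a
Redex-nnf (s-r R U T)      = s-r _ _ _
Redex-nnf (q↓-r R U T V)   = q↓-r _ _ _ _
Redex-nnf (q↑-r R U T V)   = q↑-r _ _ _ _
Redex-nnf (p↓-r R T)       = p↓-r _ _
Redex-nnf (p↑-r R T)       = p↑-r _ _
Redex-nnf e↓-r             = e↓-r
Redex-nnf e↑-r             = e↑-r
Redex-nnf (w↑-r R)         = w↑-r _
Redex-nnf (g↓-r R)         = g↓-r _

-- BoxEdit K A A′: A′ is A with one box ?Y or !Y, not itself under a modality, replaced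
-- by ?Y′ or !Y′, where Y = K{∘} and Y′ = K{!∘}.

data BoxEdit (K : Ctx) : Str → Str → Set where
  atWn   : ∀ {Y Y′} → Y ≈ K ⟦ unit ⟧ → Y′ ≈ K ⟦ !∘ ⟧ → BoxEdit K (wn Y) (wn Y′)
  atOc   : ∀ {Y Y′} → Y ≈ K ⟦ unit ⟧ → Y′ ≈ K ⟦ !∘ ⟧ → BoxEdit K (oc Y) (oc Y′)
  inParˡ : ∀ {A A′ B} → BoxEdit K A A′ → BoxEdit K (par A B) (par A′ B)
  inParʳ : ∀ {A B B′} → BoxEdit K B B′ → BoxEdit K (par A B) (par A B′)
  inTenˡ : ∀ {A A′ B} → BoxEdit K A A′ → BoxEdit K (ten A B) (ten A′ B)
  inTenʳ : ∀ {A B B′} → BoxEdit K B B′ → BoxEdit K (ten A B) (ten A B′)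
  inSeqˡ : ∀ {A A′ B} → BoxEdit K A A′ → BoxEdit K (seq A B) (seq A′ B)
  inSeqʳ : ∀ {A B B′} → BoxEdit K B B′ → BoxEdit K (seq A B) (seq A B′)

BoxEdit⇒Inst : ∀ {K A A′} → BoxEdit K A A′ → Inst e↓ A A′
BoxEdit⇒Inst {K} (atWn y y′) = Inst-lift (wnᶜ hole) (e↓-in K y y′)
BoxEdit⇒Inst {K} (atOc y y′) = Inst-lift (ocᶜ hole) (e↓-in K y y′)
BoxEdit⇒Inst (inParˡ {B = B} e) = Inst-lift (parˡ hole B) (BoxEdit⇒Inst e)
BoxEdit⇒Inst (inParʳ {A = A} e) = Inst-lift (parʳ A hole) (BoxEdit⇒Inst e)
BoxEdit⇒Inst (inTenˡ {B = B} e) = Inst-lift (tenˡ hole B) (BoxEdit⇒Inst e)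
BoxEdit⇒Inst (inTenʳ {A = A} e) = Inst-lift (tenʳ A hole) (BoxEdit⇒Inst e)
BoxEdit⇒Inst (inSeqˡ {B = B} e) = Inst-lift (seqˡ hole B) (BoxEdit⇒Inst e)
BoxEdit⇒Inst (inSeqʳ {A = A} e) = Inst-lift (seqʳ A hole) (BoxEdit⇒Inst e)

BoxEdit⇒Inst-nnf : ∀ {K A A′} → BoxEdit K (nnf⁺ A) A′ → Inst e↓ A A′
BoxEdit⇒Inst-nnf {A = A} e = Inst-resp (≈-sym (nnf⁺-sound A)) ≈-refl (BoxEdit⇒Inst e)

BoxEdit-nnf : ∀ {K A A′} → BoxEdit K A A′ → BoxEdit K (nnf⁺ A) (nnf⁺ A′)
BoxEdit-nnf (atWn {Y} {Y′} y y′) = atWn (≈-trans (nnf⁺-sound Y) y) (≈-trans (nnf⁺-sound Y′) y′)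
BoxEdit-nnf (atOc {Y} {Y′} y y′) = atOc (≈-trans (nnf⁺-sound Y) y) (≈-trans (nnf⁺-sound Y′) y′)
BoxEdit-nnf (inParˡ e) = inParˡ (BoxEdit-nnf e)
BoxEdit-nnf (inParʳ e) = inParʳ (BoxEdit-nnf e)
BoxEdit-nnf (inTenˡ e) = inTenˡ (BoxEdit-nnf e)
BoxEdit-nnf (inTenʳ e) = inTenʳ (BoxEdit-nnf e)
BoxEdit-nnf (inSeqˡ e) = inSeqˡ (BoxEdit-nnf e)
BoxEdit-nnf (inSeqʳ e) = inSeqʳ (BoxEdit-nnf e)

BoxEdit-Transports : Ctx → Str → Str → Set
BoxEdit-Transports K A B =
  ∀ {A′} → BoxEdit K A A′ → Σ[ B′ ∈ Str ] (BoxEdit K B B′ × A′ ≈ B′)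

BoxEdit-transport  : ∀ {K A B} → A ≈⁺ B → BoxEdit-Transports K A B
BoxEdit-transport⁻ : ∀ {K A B} → A ≈⁺ B → BoxEdit-Transports K B A

BoxEdit-transport ≈-refl e = _ , e , ≈-refl
BoxEdit-transport (≈-sym p) e = BoxEdit-transport⁻ p e
BoxEdit-transport (≈-trans p q) e with BoxEdit-transport p e
... | _ , e′ , eq with BoxEdit-transport q e′
... | _ , e″ , eq′ = _ , e″ , ≈-trans eq eq′
BoxEdit-transport (par-cong p q) (inParˡ e) with BoxEdit-transport p e
... | _ , e′ , eq = _ , inParˡ e′ , par-cong eq (≈⁺⇒≈ q)
BoxEdit-transport (par-cong p q) (inParʳ e) with BoxEdit-transport q e
... | _ , e′ , eq = _ , inParʳ e′ , par-cong (≈⁺⇒≈ p) eq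
BoxEdit-transport (ten-cong p q) (inTenˡ e) with BoxEdit-transport p e
... | _ , e′ , eq = _ , inTenˡ e′ , ten-cong eq (≈⁺⇒≈ q)
BoxEdit-transport (ten-cong p q) (inTenʳ e) with BoxEdit-transport q e
... | _ , e′ , eq = _ , inTenʳ e′ , ten-cong (≈⁺⇒≈ p) eq
BoxEdit-transport (seq-cong p q) (inSeqˡ e) with BoxEdit-transport p e
... | _ , e′ , eq = _ , inSeqˡ e′ , seq-cong eq (≈⁺⇒≈ q)
BoxEdit-transport (seq-cong p q) (inSeqʳ e) with BoxEdit-transport q e
... | _ , e′ , eq = _ , inSeqʳ e′ , seq-cong (≈⁺⇒≈ p) eq
BoxEdit-transport (wn-cong p) (atWn y y′) = _ , atWn (≈-trans (≈-sym (≈⁺⇒≈ p)) y) y′ , ≈-refl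
BoxEdit-transport (oc-cong p) (atOc y y′) = _ , atOc (≈-trans (≈-sym (≈⁺⇒≈ p)) y) y′ , ≈-refl
BoxEdit-transport par-assoc (inParˡ (inParˡ e)) = _ , inParˡ e , par-assoc
BoxEdit-transport par-assoc (inParˡ (inParʳ e)) = _ , inParʳ (inParˡ e) , par-assoc
BoxEdit-transport par-assoc (inParʳ e) = _ , inParʳ (inParʳ e) , par-assoc
BoxEdit-transport ten-assoc (inTenˡ (inTenˡ e)) = _ , inTenˡ e , ten-assoc
BoxEdit-transport ten-assoc (inTenˡ (inTenʳ e)) = _ , inTenʳ (inTenˡ e) , ten-assoc
BoxEdit-transport ten-assoc (inTenʳ e) = _ , inTenʳ (inTenʳ e) , ten-assoc
BoxEdit-transport seq-assoc (inSeqˡ (inSeqˡ e)) = _ , inSeqˡ e , seq-assoc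
BoxEdit-transport seq-assoc (inSeqˡ (inSeqʳ e)) = _ , inSeqʳ (inSeqˡ e) , seq-assoc
BoxEdit-transport seq-assoc (inSeqʳ e) = _ , inSeqʳ (inSeqʳ e) , seq-assoc
BoxEdit-transport par-comm (inParˡ e) = _ , inParʳ e , par-comm
BoxEdit-transport par-comm (inParʳ e) = _ , inParˡ e , par-comm
BoxEdit-transport ten-comm (inTenˡ e) = _ , inTenʳ e , ten-comm
BoxEdit-transport ten-comm (inTenʳ e) = _ , inTenˡ e , ten-comm
BoxEdit-transport par-unitˡ (inParʳ e) = _ , e , par-unitˡ
BoxEdit-transport par-unitʳ (inParˡ e) = _ , e , par-unitʳ
BoxEdit-transport ten-unitˡ (inTenʳ e) = _ , e , ten-unitˡ
BoxEdit-transport ten-unitʳ (inTenˡ e) = _ , e , ten-unitʳ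
BoxEdit-transport seq-unitˡ (inSeqʳ e) = _ , e , seq-unitˡ
BoxEdit-transport seq-unitʳ (inSeqˡ e) = _ , e , seq-unitʳ
BoxEdit-transport par-unitˡ (inParˡ ())
BoxEdit-transport par-unitʳ (inParʳ ())
BoxEdit-transport ten-unitˡ (inTenˡ ())
BoxEdit-transport ten-unitʳ (inTenʳ ())
BoxEdit-transport seq-unitˡ (inSeqˡ ())
BoxEdit-transport seq-unitʳ (inSeqʳ ())

BoxEdit-transport⁻ ≈-refl e = _ , e , ≈-refl
BoxEdit-transport⁻ (≈-sym p) e = BoxEdit-transport p e
BoxEdit-transport⁻ (≈-trans p q) e with BoxEdit-transport⁻ q e
... | _ , e′ , eq with BoxEdit-transport⁻ p e′
... | _ , e″ , eq′ = _ , e″ , ≈-trans eq eq′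
BoxEdit-transport⁻ (par-cong p q) (inParˡ e) with BoxEdit-transport⁻ p e
... | _ , e′ , eq = _ , inParˡ e′ , par-cong eq (≈-sym (≈⁺⇒≈ q))
BoxEdit-transport⁻ (par-cong p q) (inParʳ e) with BoxEdit-transport⁻ q e
... | _ , e′ , eq = _ , inParʳ e′ , par-cong (≈-sym (≈⁺⇒≈ p)) eq
BoxEdit-transport⁻ (ten-cong p q) (inTenˡ e) with BoxEdit-transport⁻ p e
... | _ , e′ , eq = _ , inTenˡ e′ , ten-cong eq (≈-sym (≈⁺⇒≈ q))
BoxEdit-transport⁻ (ten-cong p q) (inTenʳ e) with BoxEdit-transport⁻ q e
... | _ , e′ , eq = _ , inTenʳ e′ , ten-cong (≈-sym (≈⁺⇒≈ p)) eq
BoxEdit-transport⁻ (seq-cong p q) (inSeqˡ e) with BoxEdit-transport⁻ p e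
... | _ , e′ , eq = _ , inSeqˡ e′ , seq-cong eq (≈-sym (≈⁺⇒≈ q))
BoxEdit-transport⁻ (seq-cong p q) (inSeqʳ e) with BoxEdit-transport⁻ q e
... | _ , e′ , eq = _ , inSeqʳ e′ , seq-cong (≈-sym (≈⁺⇒≈ p)) eq
BoxEdit-transport⁻ (wn-cong p) (atWn y y′) = _ , atWn (≈-trans (≈⁺⇒≈ p) y) y′ , ≈-refl
BoxEdit-transport⁻ (oc-cong p) (atOc y y′) = _ , atOc (≈-trans (≈⁺⇒≈ p) y) y′ , ≈-refl
BoxEdit-transport⁻ par-assoc (inParˡ e) = _ , inParˡ (inParˡ e) , ≈-sym par-assoc
BoxEdit-transport⁻ par-assoc (inParʳ (inParˡ e)) = _ , inParˡ (inParʳ e) , ≈-sym par-assoc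
BoxEdit-transport⁻ par-assoc (inParʳ (inParʳ e)) = _ , inParʳ e , ≈-sym par-assoc
BoxEdit-transport⁻ ten-assoc (inTenˡ e) = _ , inTenˡ (inTenˡ e) , ≈-sym ten-assoc
BoxEdit-transport⁻ ten-assoc (inTenʳ (inTenˡ e)) = _ , inTenˡ (inTenʳ e) , ≈-sym ten-assoc
BoxEdit-transport⁻ ten-assoc (inTenʳ (inTenʳ e)) = _ , inTenʳ e , ≈-sym ten-assoc
BoxEdit-transport⁻ seq-assoc (inSeqˡ e) = _ , inSeqˡ (inSeqˡ e) , ≈-sym seq-assoc
BoxEdit-transport⁻ seq-assoc (inSeqʳ (inSeqˡ e)) = _ , inSeqˡ (inSeqʳ e) , ≈-sym seq-assoc
BoxEdit-transport⁻ seq-assoc (inSeqʳ (inSeqʳ e)) = _ , inSeqʳ e , ≈-sym seq-assoc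
BoxEdit-transport⁻ par-comm (inParˡ e) = _ , inParʳ e , par-comm
BoxEdit-transport⁻ par-comm (inParʳ e) = _ , inParˡ e , par-comm
BoxEdit-transport⁻ ten-comm (inTenˡ e) = _ , inTenʳ e , ten-comm
BoxEdit-transport⁻ ten-comm (inTenʳ e) = _ , inTenˡ e , ten-comm
BoxEdit-transport⁻ par-unitˡ e = _ , inParʳ e , ≈-sym par-unitˡ
BoxEdit-transport⁻ par-unitʳ e = _ , inParˡ e , ≈-sym par-unitʳ
BoxEdit-transport⁻ ten-unitˡ e = _ , inTenʳ e , ≈-sym ten-unitˡ
BoxEdit-transport⁻ ten-unitʳ e = _ , inTenˡ e , ≈-sym ten-unitʳ
BoxEdit-transport⁻ seq-unitˡ e = _ , inSeqʳ e , ≈-sym seq-unitˡ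
BoxEdit-transport⁻ seq-unitʳ e = _ , inSeqˡ e , ≈-sym seq-unitʳ

outermost-box : ∀ K →
  ModalityFree K ⊎ Σ[ K′ ∈ Ctx ] (size K′ < size K × BoxEdit K′ (K ⟦ unit ⟧) (K ⟦ !∘ ⟧))
outermost-box hole       = inj₁ tt
outermost-box (parˡ K _) = map₂ (λ (K′ , lt , e) → K′ , m<n⇒m<1+n lt , inParˡ e) (outermost-box K)
outermost-box (parʳ _ K) = map₂ (λ (K′ , lt , e) → K′ , m<n⇒m<1+n lt , inParʳ e) (outermost-box K)
outermost-box (tenˡ K _) = map₂ (λ (K′ , lt , e) → K′ , m<n⇒m<1+n lt , inTenˡ e) (outermost-box K)
outermost-box (tenʳ _ K) = map₂ (λ (K′ , lt , e) → K′ , m<n⇒m<1+n lt , inTenʳ e) (outermost-box K)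
outermost-box (seqˡ K _) = map₂ (λ (K′ , lt , e) → K′ , m<n⇒m<1+n lt , inSeqˡ e) (outermost-box K)
outermost-box (seqʳ _ K) = map₂ (λ (K′ , lt , e) → K′ , m<n⇒m<1+n lt , inSeqʳ e) (outermost-box K)
outermost-box (wnᶜ K)    = inj₂ (K , n<1+n _ , atWn ≈-refl ≈-refl)
outermost-box (ocᶜ K)    = inj₂ (K , n<1+n _ , atOc ≈-refl ≈-refl)

data Located (K : Ctx) (A : Str) : Set where
  modality-free : ModalityFree K → Located K A
  boxed : ∀ K′ {A′} → size K′ < size K → BoxEdit K′ (nnf⁺ A) A′ → K ⟦ !∘ ⟧ ≈ A′ →
          Located K A

locate : ∀ K A → K ⟦ unit ⟧ ≈ A → Located K A
locate K A p with outermost-box K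
... | inj₁ mf = modality-free mf
... | inj₂ (K′ , lt , e) with BoxEdit-transport (proj₁ (≈⇒nnf-≈⁺ p)) (BoxEdit-nnf e)
... | _ , e′ , eq = boxed K′ lt e′ (≈-trans (≈-sym (nnf⁺-sound _)) eq)

data PlugEdit (K C : Ctx) (Y P : Str) : Set where
  beside : ∀ C′ → (∀ Z → Inst e↓ (C ⟦ Z ⟧) (C′ ⟦ Z ⟧)) → P ≈ C′ ⟦ Y ⟧ →
           PlugEdit K C Y P
  inside : ∀ {Y′} → BoxEdit K Y Y′ → P ≈ C ⟦ Y′ ⟧ → PlugEdit K C Y P
  around : ∀ B C₁ → (∀ Z → C ⟦ Z ⟧ ≡ B ⟦ C₁ ⟦ Z ⟧ ⟧) → C₁ ⟦ Y ⟧ ≈ K ⟦ unit ⟧ →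
           P ≈ B ⟦ K ⟦ !∘ ⟧ ⟧ → PlugEdit K C Y P

PlugEdit-lift : ∀ {K C Y P} F → PlugEdit K C Y P → PlugEdit K (F ∘ᶜ C) Y (F ⟦ P ⟧)
PlugEdit-lift {C = C} {Y} F (beside C′ i p) =
  beside (F ∘ᶜ C′)
    (λ Z → Inst-resp (≡⇒≈ (∘ᶜ-⟦⟧ F C Z)) (≡⇒≈ (sym (∘ᶜ-⟦⟧ F C′ Z))) (Inst-lift F (i Z)))
    (≈-trans (⟦⟧-cong F p) (≡⇒≈ (sym (∘ᶜ-⟦⟧ F C′ Y))))
PlugEdit-lift {C = C} F (inside {Y′} e p) =
  inside e (≈-trans (⟦⟧-cong F p) (≡⇒≈ (sym (∘ᶜ-⟦⟧ F C Y′))))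
PlugEdit-lift {K} {C} F (around B C₁ eqC c p) =
  around (F ∘ᶜ B) C₁
    (λ Z → trans (∘ᶜ-⟦⟧ F C Z)
             (trans (cong (F ⟦_⟧) (eqC Z)) (sym (∘ᶜ-⟦⟧ F B (C₁ ⟦ Z ⟧)))))
    c (≈-trans (⟦⟧-cong F p) (≡⇒≈ (sym (∘ᶜ-⟦⟧ F B (K ⟦ !∘ ⟧)))))

plug-view : ∀ {K} C Y {P} → BoxEdit K (C ⟦ Y ⟧) P → PlugEdit K C Y P
plug-view hole Y e = inside e ≈-refl
plug-view (parˡ C W) Y (inParˡ e) = PlugEdit-lift (parˡ hole W) (plug-view C Y e)
plug-view (parʳ W C) Y (inParʳ e) = PlugEdit-lift (parʳ W hole) (plug-view C Y e)
plug-view (tenˡ C W) Y (inTenˡ e) = PlugEdit-lift (tenˡ hole W) (plug-view C Y e)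
plug-view (tenʳ W C) Y (inTenʳ e) = PlugEdit-lift (tenʳ W hole) (plug-view C Y e)
plug-view (seqˡ C W) Y (inSeqˡ e) = PlugEdit-lift (seqˡ hole W) (plug-view C Y e)
plug-view (seqʳ W C) Y (inSeqʳ e) = PlugEdit-lift (seqʳ W hole) (plug-view C Y e)
plug-view (parˡ C W) Y (inParʳ e) =
  beside (parˡ C _) (λ Z → Inst-lift (parʳ (C ⟦ Z ⟧) hole) (BoxEdit⇒Inst e)) ≈-refl
plug-view (parʳ W C) Y (inParˡ e) =
  beside (parʳ _ C) (λ Z → Inst-lift (parˡ hole (C ⟦ Z ⟧)) (BoxEdit⇒Inst e)) ≈-refl
plug-view (tenˡ C W) Y (inTenʳ e) =
  beside (tenˡ C _) (λ Z → Inst-lift (tenʳ (C ⟦ Z ⟧) hole) (BoxEdit⇒Inst e)) ≈-refl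
plug-view (tenʳ W C) Y (inTenˡ e) =
  beside (tenʳ _ C) (λ Z → Inst-lift (tenˡ hole (C ⟦ Z ⟧)) (BoxEdit⇒Inst e)) ≈-refl
plug-view (seqˡ C W) Y (inSeqʳ e) =
  beside (seqˡ C _) (λ Z → Inst-lift (seqʳ (C ⟦ Z ⟧) hole) (BoxEdit⇒Inst e)) ≈-refl
plug-view (seqʳ W C) Y (inSeqˡ e) =
  beside (seqʳ _ C) (λ Z → Inst-lift (seqˡ hole (C ⟦ Z ⟧)) (BoxEdit⇒Inst e)) ≈-refl
plug-view (wnᶜ C) Y (atWn y y′) = around (wnᶜ hole) C (λ _ → refl) y (wn-cong y′)
plug-view (ocᶜ C) Y (atOc y y′) = around (ocᶜ hole) C (λ _ → refl) y (oc-cong y′)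

module _ {X : Rule → Set} (s∈X : X s) (q↑∈X : X q↑) where

  commute : ∀ {ρ R R′ T} → Inst e↓ R R′ → Redex ρ R′ T → Permuted X ρ R T
  commute i r = _ , _ , i , Redex⇒Inst r , single ≈-refl

  permute-modality-free : ∀ {ρ K Q U P} → ModalityFree K →
    Inst ρ Q U → U ≈ K ⟦ unit ⟧ → P ≈ K ⟦ !∘ ⟧ → Permuted X ρ Q P
  permute-modality-free {K = K} {Q} {U} mf i u p =
    ten !∘ Q , ten !∘ U ,
    e↓-in (tenˡ hole Q) (≈-sym ten-unitˡ) ≈-refl , Inst-lift (tenʳ !∘ hole) i ,
    Deriv-trans (single (ten-cong ≈-refl u))
      (Deriv-trans (ten-into-hole s∈X q↑∈X !∘ K mf) (single (≈-sym p)))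

  permute-in-p↑-box : ∀ {K R T Y′} → ten R T ≈ K ⟦ unit ⟧ → Y′ ≈ K ⟦ !∘ ⟧ →
    Permuted X p↑ (ten (wn R) (oc T)) (wn Y′)
  permute-in-p↑-box {K} {R} {T} y y′ with locate K (ten R T) (≈-sym y)
  ... | modality-free mf =
    _ , _ , Inst-lift (tenˡ (wnᶜ hole) (oc T)) (e↓-in (tenˡ hole R) (≈-sym ten-unitˡ) ≈-refl) ,
    Redex⇒Inst (p↑-r (ten !∘ R) T) ,
    Deriv-trans (single (wn-cong (≈-trans ten-assoc (ten-cong ≈-refl y))))
      (Deriv-lift (wnᶜ hole) (Deriv-trans (ten-into-hole s∈X q↑∈X !∘ K mf) (single (≈-sym y′))))
  ... | boxed _ _ (inTenˡ e) eq =
    Permuted-resp ≈-refl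
      (wn-cong (≈-trans (ten-cong ≈-refl (≈-sym (nnf⁺-sound T))) (≈-trans (≈-sym eq) (≈-sym y′))))
      (commute (Inst-lift (tenˡ (wnᶜ hole) (oc T)) (BoxEdit⇒Inst-nnf e))
        (p↑-r _ T))
  ... | boxed _ _ (inTenʳ e) eq =
    Permuted-resp ≈-refl
      (wn-cong (≈-trans (ten-cong (≈-sym (nnf⁺-sound R)) ≈-refl) (≈-trans (≈-sym eq) (≈-sym y′))))
      (commute (Inst-lift (tenʳ (wn R) (ocᶜ hole)) (BoxEdit⇒Inst-nnf e))
        (p↑-r R _))

  -- K{∘} = ∘ leaves no room for a box in K.
  permute-in-e↓-box : ∀ {K Y′} → unit ≈ K ⟦ unit ⟧ → Y′ ≈ K ⟦ !∘ ⟧ →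
    Permuted X e↓ unit (oc Y′)
  permute-in-e↓-box {K} y y′ with locate K unit (≈-sym y)
  ... | modality-free mf =
    !∘ , oc !∘ , e↓-in hole ≈-refl ≈-refl , Inst-lift (ocᶜ hole) (e↓-in hole ≈-refl ≈-refl) ,
    Deriv-lift (ocᶜ hole)
      (Deriv-trans (single (≈-trans (≈-sym ten-unitʳ) (ten-cong ≈-refl y)))
        (Deriv-trans (ten-into-hole s∈X q↑∈X !∘ K mf) (single (≈-sym y′))))
  ... | boxed _ _ () _

  permute-in-contractum : ∀ {ρ R T K P} → Redex ρ R T → BoxEdit K T P → Permuted X ρ R P
  permute-in-contractum (ai↓-r a) (inParˡ ())
  permute-in-contractum (ai↓-r a) (inParʳ ())
  permute-in-contractum (ai↑-r a) ()
  permute-in-contractum e↑-r ()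
  permute-in-contractum (w↑-r _) ()
  permute-in-contractum (s-r R U T) (inParˡ (inTenˡ e)) =
    commute (Inst-lift (tenˡ (parˡ hole U) T) (BoxEdit⇒Inst e)) (s-r _ U T)
  permute-in-contractum (s-r R U T) (inParˡ (inTenʳ e)) =
    commute (Inst-lift (tenʳ (par R U) hole) (BoxEdit⇒Inst e)) (s-r R U _)
  permute-in-contractum (s-r R U T) (inParʳ e) =
    commute (Inst-lift (tenˡ (parʳ R hole) T) (BoxEdit⇒Inst e)) (s-r R _ T)
  permute-in-contractum (q↓-r R U T V) (inParˡ (inSeqˡ e)) =
    commute (Inst-lift (seqˡ (parˡ hole U) (par T V)) (BoxEdit⇒Inst e)) (q↓-r _ U T V)
  permute-in-contractum (q↓-r R U T V) (inParˡ (inSeqʳ e)) =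
    commute (Inst-lift (seqʳ (par R U) (parˡ hole V)) (BoxEdit⇒Inst e)) (q↓-r R U _ V)
  permute-in-contractum (q↓-r R U T V) (inParʳ (inSeqˡ e)) =
    commute (Inst-lift (seqˡ (parʳ R hole) (par T V)) (BoxEdit⇒Inst e)) (q↓-r R _ T V)
  permute-in-contractum (q↓-r R U T V) (inParʳ (inSeqʳ e)) =
    commute (Inst-lift (seqʳ (par R U) (parʳ T hole)) (BoxEdit⇒Inst e)) (q↓-r R U T _)
  permute-in-contractum (q↑-r R U T V) (inSeqˡ (inTenˡ e)) =
    commute (Inst-lift (tenˡ (seqˡ hole U) (seq T V)) (BoxEdit⇒Inst e)) (q↑-r _ U T V)
  permute-in-contractum (q↑-r R U T V) (inSeqˡ (inTenʳ e)) =
    commute (Inst-lift (tenʳ (seq R U) (seqˡ hole V)) (BoxEdit⇒Inst e)) (q↑-r R U _ V)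
  permute-in-contractum (q↑-r R U T V) (inSeqʳ (inTenˡ e)) =
    commute (Inst-lift (tenˡ (seqʳ R hole) (seq T V)) (BoxEdit⇒Inst e)) (q↑-r R _ T V)
  permute-in-contractum (q↑-r R U T V) (inSeqʳ (inTenʳ e)) =
    commute (Inst-lift (tenʳ (seq R U) (seqʳ T hole)) (BoxEdit⇒Inst e)) (q↑-r R U T _)
  permute-in-contractum {K = K} (p↓-r R T) (inParˡ (atOc y y′)) =
    commute (Inst-lift (ocᶜ (parˡ hole T)) (e↓-in K y y′)) (p↓-r _ T)
  permute-in-contractum {K = K} (p↓-r R T) (inParʳ (atWn y y′)) =
    commute (Inst-lift (ocᶜ (parʳ R hole)) (e↓-in K y y′)) (p↓-r R _)
  permute-in-contractum {K = K} (g↓-r R) (atWn y y′) =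
    commute (Inst-lift (wnᶜ (wnᶜ hole)) (e↓-in K y y′)) (g↓-r _)
  permute-in-contractum (p↑-r R T) (atWn y y′) = permute-in-p↑-box y y′
  permute-in-contractum e↓-r (atOc y y′) = permute-in-e↓-box y y′

  permute : ∀ {ρ} n K → size K < n → ∀ {Q U P} →
    Inst ρ Q U → U ≈ K ⟦ unit ⟧ → P ≈ K ⟦ !∘ ⟧ → Permuted X ρ Q P
  permute {ρ} (suc n) K sz {Q} {P = P} i@(S , R , T , r , q , u) u′ p
    with locate K (S ⟦ T ⟧) (≈-trans (≈-sym u′) u)
  ... | modality-free mf = permute-modality-free mf i u′ p
  ... | boxed K′ {A′} lt e eq =
    by-view (plug-view Sₙ Tₙ (subst (λ A → BoxEdit K′ A A′) (nnf⁺-⟦⟧ S T) e))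
    where
    Sₙ : Ctx
    Sₙ = nnfᶜ S
    Rₙ Tₙ : Str
    Rₙ = nnf⁺ R
    Tₙ = nnf⁺ T
    rₙ : ∀ C → Inst ρ (C ⟦ Rₙ ⟧) (C ⟦ Tₙ ⟧)
    rₙ C = Inst-lift C (Redex⇒Inst (Redex-nnf r))
    Q≈ : Q ≈ Sₙ ⟦ Rₙ ⟧
    Q≈ = ≈-trans q (≈-trans (≈-sym (nnf⁺-sound _)) (≡⇒≈ (nnf⁺-⟦⟧ S R)))
    A′≈ : A′ ≈ P
    A′≈ = ≈-trans (≈-sym eq) (≈-sym p)
    by-view : PlugEdit K′ Sₙ Tₙ A′ → Permuted X ρ Q P
    by-view (beside C′ i′ p′) =
      C′ ⟦ Rₙ ⟧ , C′ ⟦ Tₙ ⟧ , Inst-resp Q≈ ≈-refl (i′ Rₙ) , rₙ C′ , single (≈-trans (≈-sym p′) A′≈)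
    by-view (inside e′ p′) =
      Permuted-resp Q≈ (≈-trans (≈-sym p′) A′≈)
        (Permuted-lift Sₙ (permute-in-contractum (Redex-nnf r) e′))
    by-view (around B C₁ eqC c p′) =
      Permuted-resp (≈-trans Q≈ (≡⇒≈ (eqC Rₙ))) (≈-trans (≈-sym p′) A′≈)
        (Permuted-lift B (permute n K′ (<-≤-trans lt (s≤s⁻¹ sz)) (rₙ C₁) c ≈-refl))

  e↓-permutes-over : ∀ ρ → PermutesOver e↓ ρ X
  e↓-permutes-over ρ i (K , _ , _ , e↓-r , u , p) = permute (suc (size K)) K (n<1+n _) i u p

-- e↓ permutes even over itself.
lemma4p3 : (ρ : Rule) → ρ ∈ (e↑ ∷ ai↓ ∷ ai↑ ∷ s ∷ q↓ ∷ q↑ ∷ p↓ ∷ p↑ ∷ w↑ ∷ g↓ ∷ []) →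
    PermutesOver e↓ ρ (System (s ∷ q↓ ∷ q↑ ∷ []))
lemma4p3 ρ _ = e↓-permutes-over (here refl) (there (there (here refl))) ρ
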